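{- For an integer $k\ge 2$, let $\{F_n^{(k)}\}_{n\ge -(k-2)}$ be the $k$-generalized Fibonacci sequence, defined by $F_{ -(k-2)}^{(k)}=\cdots=F_0^{(k)}=0$, $F_1^{(k)}=1$, and $F_n^{(k)}=\sum_{i=1}^{k}F_{n-i}^{(k)}$ for all $n\ge 2$. Then for all integers $m\ge 3$ and $k\ge 3$, \[ \frac{F_{m-1}^{(k)}}{F_{m+1}^{(k)}}\le \frac{3}{7}. \] -}

module Defs where

open import Data.Nat using (ℕ; zero; suc; _+_)
open import Data.List using (List; []; _∷_; take)
open import Data.Nat.ListAction using (sum)

-- fibsRev k n = [F⁽ᵏ⁾ n , F⁽ᵏ⁾ (n-1) , … , F⁽ᵏ⁾ 0]  (most recent first).
-- Terms with negative index (F_{-(k-2)} … F_{-1}) are all 0, so they are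
-- omitted: summing the first k entries of this list equals the sum of the
-- k previous terms of the sequence including the zero initial terms.
fibsRev : ℕ → ℕ → List ℕ
fibsRev k zero = 0 ∷ []
fibsRev k (suc zero) = 1 ∷ 0 ∷ []
fibsRev k (suc (suc n)) with fibsRev k (suc n)
... | xs = sum (take k xs) ∷ xs

F : ℕ → ℕ → ℕ
F k n with fibsRev k n
... | [] = 0
... | x ∷ _ = x

-- For k ≥ 3 write Fₙ for F_n^{(k)}. Each term is at most twice its predecessor, since
-- Fₙ₊₂ = Fₙ₊₁ + (part of the window summing to Fₙ₊₁), and each term is at least the sum
-- of the three before it. So F_{m+1} ≥ F_m + F_{m-1} + F_{m-2} ≥ 2 F_{m-1} + 2 F_{m-2},
-- and 3 F_{m+1} ≥ 6 F_{m-1} + 6 F_{m-2} ≥ 6 F_{m-1} + 3 F_{m-1} ≥ 7 F_{m-1}.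
module Submission where

open import Defs
open import Data.Nat using (ℕ; _≤_; _*_; _∸_; _+_; suc; zero; z≤n; s≤s)
open import Data.Nat.Properties
open import Data.List using (List; []; _∷_; take)
open import Data.Nat.ListAction using (sum)
open import Relation.Binary.PropositionalEquality using (_≡_; refl; cong)
open import Data.Nat.Tactic.RingSolver using (solve-∀)

sum-take-mono : ∀ n (xs : List ℕ) → sum (take n xs) ≤ sum (take (suc n) xs)
sum-take-mono zero    xs       = z≤n
sum-take-mono (suc n) []       = z≤n
sum-take-mono (suc n) (x ∷ xs) = +-monoʳ-≤ x (sum-take-mono n xs)

fibsRev-suc : ∀ k n → fibsRev k (suc n) ≡ F k (suc n) ∷ fibsRev k n
fibsRev-suc k zero    = refl
fibsRev-suc k (suc n) = refl

F-recurrence : ∀ k n →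
  F (suc k) (2 + n) ≡ F (suc k) (1 + n) + sum (take k (fibsRev (suc k) n))
F-recurrence k n = cong (λ xs → sum (take (suc k) xs)) (fibsRev-suc (suc k) n)

F≤sum-take : ∀ k j n → F k n ≤ sum (take (suc j) (fibsRev k n))
F≤sum-take k j n with fibsRev k n
... | []     = z≤n
... | x ∷ xs = m≤m+n x _

sum-take≤F-suc : ∀ k n → sum (take k (fibsRev k n)) ≤ F k (suc n)
sum-take≤F-suc zero          zero    = z≤n
sum-take≤F-suc (suc zero)    zero    = z≤n
sum-take≤F-suc (suc (suc k)) zero    = z≤n
sum-take≤F-suc k             (suc n) = ≤-refl

F-suc-suc≤double : ∀ k n → F k (2 + n) ≤ 2 * F k (1 + n)
F-suc-suc≤double zero    n = z≤n
F-suc-suc≤double (suc k) n = begin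
  F (suc k) (2 + n)                               ≡⟨ F-recurrence k n ⟩
  F (suc k) (1 + n) + sum (take k (fibsRev _ n))  ≤⟨ +-monoʳ-≤ _ window≤F ⟩
  F (suc k) (1 + n) + F (suc k) (1 + n)           ≡⟨ cong (F (suc k) (1 + n) +_) (+-identityʳ _) ⟨
  2 * F (suc k) (1 + n)                           ∎
  where
  open ≤-Reasoning
  window≤F : sum (take k (fibsRev (suc k) n)) ≤ F (suc k) (1 + n)
  window≤F = ≤-trans (sum-take-mono k _) (sum-take≤F-suc (suc k) n)

F-three≤F : ∀ k n → 3 ≤ k → F k (2 + n) + (F k (1 + n) + F k n) ≤ F k (3 + n)
F-three≤F k@(suc (suc (suc k'))) n (s≤s (s≤s (s≤s _))) = begin
  F k (2 + n) + (F k (1 + n) + F k n)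
    ≤⟨ +-monoʳ-≤ (F k (2 + n)) (+-monoʳ-≤ (F k (1 + n)) (F≤sum-take k k' n)) ⟩
  F k (2 + n) + (F k (1 + n) + sum (take (suc k') (fibsRev k n)))
    ≡⟨ cong (λ xs → F k (2 + n) + sum (take (suc (suc k')) xs)) (fibsRev-suc k n) ⟨
  F k (2 + n) + sum (take (suc (suc k')) (fibsRev k (1 + n)))
    ≡⟨ F-recurrence (suc (suc k')) (suc n) ⟨
  F k (3 + n)
    ∎
  where open ≤-Reasoning

7y≤3w : ∀ {x y z w} → y ≤ 2 * x → y + x ≤ z → z + (y + x) ≤ w → 7 * y ≤ 3 * w
7y≤3w {x} {y} {z} {w} y≤2x y+x≤z z+y+x≤w = begin
  7 * y                   ≡⟨ seven y ⟩
  6 * y + y               ≤⟨ +-monoʳ-≤ (6 * y) (≤-trans y≤2x (*-monoˡ-≤ x (m≤m+n 2 4))) ⟩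
  6 * y + 6 * x           ≡⟨ six y x ⟩
  3 * ((y + x) + (y + x)) ≤⟨ *-monoʳ-≤ 3 (≤-trans (+-monoˡ-≤ (y + x) y+x≤z) z+y+x≤w) ⟩
  3 * w                   ∎
  where
  open ≤-Reasoning
  seven : ∀ y → 7 * y ≡ 6 * y + y
  seven = solve-∀
  six : ∀ y x → 6 * y + 6 * x ≡ 3 * ((y + x) + (y + x))
  six = solve-∀

lemma4 : ∀ (m k : ℕ) → 3 ≤ m → 3 ≤ k →
    7 * F k (m ∸ 1) ≤ 3 * F k (m + 1)
lemma4 (suc (suc (suc j))) k (s≤s (s≤s (s≤s _))) 3≤k rewrite +-comm j 1 =
  7y≤3w (F-suc-suc≤double k j)
        (≤-trans (+-monoʳ-≤ (F k (2 + j)) (m≤m+n _ _)) (F-three≤F k j 3≤k))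
        (F-three≤F k (suc j) 3≤k)
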